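{- There is an absolute constant $C$ such that for every string $w[1..n]$ over $\{1,\dots,\sigma\}$, $$\sum_{i=1}^{n}\ \sum_{k=0}^{k_i}2^k\le C\sigma n.$$
   Context: For a string $w[1..n]$ and a position $i$, let $p(i)=\max\{i'<i: w[i']=w[i]\}$ if such $i'$ exists, and $p(i)=1$ otherwise. Position $i$ is $k$-active at position $i'$ if $i'\in[p(i),i]$ and $2^k\le i-i'+1<2^{k+1}$. $k_i$ denotes the largest $k$ such that $i$ is $k$-active at some position $i'$, i.e. $k_i=\lfloor\log_2(i-p(i)+1)\rfloor$. -}

module Defs where

open import Data.Nat using (ℕ; zero; suc; _+_; _*_; _∸_; _^_; _<?_)
open import Data.Nat.Logarithm using (⌊log₂_⌋)
open import Data.Fin using (Fin; fromℕ<)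
open import Data.Fin.Properties using () renaming (_≟_ to _≟ᶠ_)
open import Relation.Nullary using (yes; no)

-- A string w[1..n] over the alphabet {1,…,σ}; letters are encoded as Fin σ
-- and positions as Fin n (position i ∈ {1..n} is the element with toℕ = i ∸ 1).
Word : ℕ → ℕ → Set
Word σ n = Fin n → Fin σ

open import Data.Maybe using (Maybe; just; nothing)

at : ∀ {σ n} → Word σ n → ℕ → Maybe (Fin σ)
at {n = n} w zero = nothing
at {n = n} w (suc j) with j <? n
... | yes j<n = just (w (fromℕ< j<n))
... | no _ = nothing

lastOcc : ∀ {σ n} → Word σ n → Fin σ → ℕ → ℕ
lastOcc w a zero = 1
lastOcc w a (suc j) with at w (suc j)
... | nothing = lastOcc w a j
... | just b with b ≟ᶠ a
...   | yes _ = suc j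
...   | no _ = lastOcc w a j

p : ∀ {σ n} → Word σ n → ℕ → ℕ
p w i with at w i
... | nothing = 1
... | just a = lastOcc w a (i ∸ 1)

kIdx : ∀ {σ n} → Word σ n → ℕ → ℕ
kIdx w i = ⌊log₂ (i ∸ p w i + 1) ⌋

sumTo : ℕ → (ℕ → ℕ) → ℕ
sumTo zero f = f 0
sumTo (suc m) f = sumTo m f + f (suc m)

sum1 : ℕ → (ℕ → ℕ) → ℕ
sum1 zero f = 0
sum1 (suc n) f = sum1 n f + f (suc n)

activeSum : ∀ {σ n} → Word σ n → ℕ
activeSum {n = n} w = sum1 n (λ i → sumTo (kIdx w i) (λ k → 2 ^ k))

{-# OPTIONS --safe #-}
-- Since Σ_{k ≤ ⌊log₂ m⌋} 2^k < 2m, the i-th summand is below 2(gap(i) + 1) with gap(i) = i − p(i).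
-- The gaps are bounded through the potential Φ(j) = Σ_a (last occurrence of a in w[1..j]):
-- reading position i raises the entry of w[i] from p(i) to i and leaves the others alone, so
-- Σ_i gap(i) ≤ Φ(n) ≤ σn, and the total is at most 2(σn + n) ≤ 4σn.
module Submission where

open import Defs
open import Data.Nat using (ℕ; zero; suc; _+_; _*_; _∸_; _^_; _≤_; _<_; _<?_; z≤n; s≤s; ⌊_/2⌋; +-0-rawMonoid)
open import Data.Nat.Properties
open import Data.Nat.Logarithm using (⌊log₂_⌋)
open import Data.Nat.Logarithm.Core using (⌊log2⌋)
open import Data.Nat.Tactic.RingSolver using (solve-∀)
open import Algebra.Definitions.RawMonoid +-0-rawMonoid using (sum)
open import Algebra.Properties.CommutativeSemigroup +-commutativeSemigroup using (x∙yz≈y∙xz)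
open import Data.Empty using (⊥-elim)
open import Data.Fin using (Fin) renaming (zero to fzero; suc to fsuc)
open import Data.Fin.Properties using (¬Fin0) renaming (_≟_ to _≟ᶠ_)
open import Data.Maybe using (just; nothing)
open import Data.Product using (∃-syntax; _,_)
open import Function using (_∘_)
open import Induction.WellFounded using (Acc; acc)
open import Relation.Nullary using (yes; no)
open import Relation.Binary.PropositionalEquality

2*⌊n/2⌋≤n : ∀ n → 2 * ⌊ n /2⌋ ≤ n
2*⌊n/2⌋≤n zero = z≤n
2*⌊n/2⌋≤n (suc zero) = z≤n
2*⌊n/2⌋≤n (suc (suc n)) = ≤-trans (≤-reflexive (*-suc 2 ⌊ n /2⌋)) (s≤s (s≤s (2*⌊n/2⌋≤n n)))

2^⌊log₂n⌋≤n : ∀ n → 1 ≤ n → 2 ^ ⌊log₂ n ⌋ ≤ n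
2^⌊log₂n⌋≤n n = 2^⌊log2⌋n≤n n _
  where
  2^⌊log2⌋n≤n : ∀ n (rec : Acc _<_ n) → 1 ≤ n → 2 ^ ⌊log2⌋ n rec ≤ n
  2^⌊log2⌋n≤n (suc zero) _ _ = ≤-refl
  2^⌊log2⌋n≤n (suc (suc n)) (acc rs) _ =
    ≤-trans (*-monoʳ-≤ 2 (2^⌊log2⌋n≤n (suc ⌊ n /2⌋) _ (s≤s z≤n))) (2*⌊n/2⌋≤n (suc (suc n)))

1+sumTo-2^≡2^1+ : ∀ k → suc (sumTo k (2 ^_)) ≡ 2 ^ suc k
1+sumTo-2^≡2^1+ zero = refl
1+sumTo-2^≡2^1+ (suc k) = begin
  suc (sumTo k (2 ^_)) + 2 ^ suc k ≡⟨ cong (_+ 2 ^ suc k) (1+sumTo-2^≡2^1+ k) ⟩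
  2 ^ suc k + 2 ^ suc k            ≡⟨ cong (2 ^ suc k +_) (sym (+-identityʳ (2 ^ suc k))) ⟩
  2 ^ suc (suc k)                  ∎
  where open ≡-Reasoning

sumTo-2^-⌊log₂⌋<2* : ∀ n → 1 ≤ n → sumTo ⌊log₂ n ⌋ (2 ^_) < 2 * n
sumTo-2^-⌊log₂⌋<2* n 1≤n = begin-strict
  sumTo ⌊log₂ n ⌋ (2 ^_)       <⟨ n<1+n _ ⟩
  suc (sumTo ⌊log₂ n ⌋ (2 ^_)) ≡⟨ 1+sumTo-2^≡2^1+ ⌊log₂ n ⌋ ⟩
  2 * 2 ^ ⌊log₂ n ⌋            ≤⟨ *-monoʳ-≤ 2 (2^⌊log₂n⌋≤n n 1≤n) ⟩
  2 * n                        ∎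
  where open ≤-Reasoning

sum1-mono-≤ : ∀ n {f g : ℕ → ℕ} → (∀ i → f i ≤ g i) → sum1 n f ≤ sum1 n g
sum1-mono-≤ zero f≤g = z≤n
sum1-mono-≤ (suc n) f≤g = +-mono-≤ (sum1-mono-≤ n f≤g) (f≤g (suc n))

sum1-*-+1 : ∀ c n (f : ℕ → ℕ) → sum1 n (λ i → c * (f i + 1)) ≡ c * (sum1 n f + n)
sum1-*-+1 c zero f = sym (*-zeroʳ c)
sum1-*-+1 c (suc n) f = begin
  sum1 n (λ i → c * (f i + 1)) + c * (f (suc n) + 1) ≡⟨ cong (_+ c * (f (suc n) + 1)) (sum1-*-+1 c n f) ⟩
  c * (sum1 n f + n) + c * (f (suc n) + 1)           ≡⟨ regroup c (sum1 n f) (f (suc n)) n ⟩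
  c * (sum1 n f + f (suc n) + (1 + n))               ∎
  where
  open ≡-Reasoning
  regroup : ∀ c s x n → c * (s + n) + c * (x + 1) ≡ c * (s + x + (1 + n))
  regroup = solve-∀

sum-mono-≤ : ∀ {m} {f g : Fin m → ℕ} → (∀ i → f i ≤ g i) → sum f ≤ sum g
sum-mono-≤ {zero} f≤g = z≤n
sum-mono-≤ {suc m} f≤g = +-mono-≤ (f≤g fzero) (sum-mono-≤ (f≤g ∘ fsuc))

sum-≤-* : ∀ {m} {f : Fin m → ℕ} {c} → (∀ i → f i ≤ c) → sum f ≤ m * c
sum-≤-* {zero} f≤c = z≤n
sum-≤-* {suc m} f≤c = +-mono-≤ (f≤c fzero) (sum-≤-* (f≤c ∘ fsuc))

g∸f+sum-f≤sum-g : ∀ {m} {f g : Fin m → ℕ} → (∀ i → f i ≤ g i) → ∀ j → g j ∸ f j + sum f ≤ sum g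
g∸f+sum-f≤sum-g {suc m} {f} {g} f≤g fzero = begin
  g fzero ∸ f fzero + (f fzero + sum (f ∘ fsuc)) ≡⟨ sym (+-assoc (g fzero ∸ f fzero) (f fzero) _) ⟩
  g fzero ∸ f fzero + f fzero + sum (f ∘ fsuc)   ≡⟨ cong (_+ sum (f ∘ fsuc)) (m∸n+n≡m (f≤g fzero)) ⟩
  g fzero + sum (f ∘ fsuc)                       ≤⟨ +-monoʳ-≤ (g fzero) (sum-mono-≤ (f≤g ∘ fsuc)) ⟩
  g fzero + sum (g ∘ fsuc)                       ∎
  where open ≤-Reasoning
g∸f+sum-f≤sum-g {suc m} {f} {g} f≤g (fsuc j) = begin
  g (fsuc j) ∸ f (fsuc j) + (f fzero + sum (f ∘ fsuc)) ≡⟨ x∙yz≈y∙xz (g (fsuc j) ∸ f (fsuc j)) (f fzero) _ ⟩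
  f fzero + (g (fsuc j) ∸ f (fsuc j) + sum (f ∘ fsuc)) ≤⟨ +-mono-≤ (f≤g fzero) (g∸f+sum-f≤sum-g (f≤g ∘ fsuc) j) ⟩
  g fzero + sum (g ∘ fsuc)                             ∎
  where open ≤-Reasoning

gap : ∀ {σ n} → Word σ n → ℕ → ℕ
gap w i = i ∸ p w i

n≤σ*n : ∀ {σ n} → Word σ n → n ≤ σ * n
n≤σ*n {n = zero} w = z≤n
n≤σ*n {zero} {suc n} w = ⊥-elim (¬Fin0 (w fzero))
n≤σ*n {suc σ} {suc n} w = m≤n*m (suc n) (suc σ)

module _ {σ n : ℕ} (w : Word σ n) where

  lastOcc-suc-≤ : ∀ a j → lastOcc w a (suc j) ≤ suc j
  lastOcc-≤ : ∀ a j → lastOcc w a j ≤ suc j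

  lastOcc-≤ a zero = ≤-refl
  lastOcc-≤ a (suc j) = m≤n⇒m≤1+n (lastOcc-suc-≤ a j)

  lastOcc-suc-≤ a j with at w (suc j)
  ... | nothing = lastOcc-≤ a j
  ... | just b with b ≟ᶠ a
  ...   | yes _ = ≤-refl
  ...   | no _ = lastOcc-≤ a j

  lastOcc-mono : ∀ a j → lastOcc w a j ≤ lastOcc w a (suc j)
  lastOcc-mono a j with at w (suc j)
  ... | nothing = ≤-refl
  ... | just b with b ≟ᶠ a
  ...   | yes _ = lastOcc-≤ a j
  ...   | no _ = ≤-refl

  letter-at : ∀ {m} → m < n → ∃[ a ] at w (suc m) ≡ just a
  letter-at {m} m<n with m <? n
  ... | yes _ = _ , refl
  ... | no m≮n = ⊥-elim (m≮n m<n)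

  lastOcc-at : ∀ {a m} → at w (suc m) ≡ just a → lastOcc w a (suc m) ≡ suc m
  lastOcc-at {m = m} at≡ with at w (suc m)
  lastOcc-at refl | just b with b ≟ᶠ b
  ... | yes _ = refl
  ... | no b≢b = ⊥-elim (b≢b refl)

  p-at : ∀ {a m} → at w (suc m) ≡ just a → p w (suc m) ≡ lastOcc w a m
  p-at {m = m} at≡ with at w (suc m)
  p-at refl | just b = refl

  lastOccSum : ℕ → ℕ
  lastOccSum j = sum (λ a → lastOcc w a j)

  gap+lastOccSum≤lastOccSum-suc : ∀ {m} → m < n → gap w (suc m) + lastOccSum m ≤ lastOccSum (suc m)
  gap+lastOccSum≤lastOccSum-suc {m} m<n with letter-at m<n
  ... | a , at≡ = begin
    gap w (suc m) + lastOccSum m                             ≡⟨ cong (_+ lastOccSum m) gap≡ ⟩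
    lastOcc w a (suc m) ∸ lastOcc w a m + lastOccSum m       ≤⟨ g∸f+sum-f≤sum-g (λ b → lastOcc-mono b m) a ⟩
    lastOccSum (suc m)                                       ∎
    where
    open ≤-Reasoning
    gap≡ : gap w (suc m) ≡ lastOcc w a (suc m) ∸ lastOcc w a m
    gap≡ = cong₂ _∸_ (sym (lastOcc-at at≡)) (p-at at≡)

  sum1-gap≤lastOccSum : ∀ m → m ≤ n → sum1 m (gap w) ≤ lastOccSum m
  sum1-gap≤lastOccSum zero _ = z≤n
  sum1-gap≤lastOccSum (suc m) m<n = begin
    sum1 m (gap w) + gap w (suc m) ≤⟨ +-monoˡ-≤ _ (sum1-gap≤lastOccSum m (<⇒≤ m<n)) ⟩
    lastOccSum m + gap w (suc m)   ≡⟨ +-comm (lastOccSum m) _ ⟩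
    gap w (suc m) + lastOccSum m   ≤⟨ gap+lastOccSum≤lastOccSum-suc m<n ⟩
    lastOccSum (suc m)             ∎
    where open ≤-Reasoning

sum1-gap≤σ*n : ∀ {σ n} (w : Word σ n) → sum1 n (gap w) ≤ σ * n
sum1-gap≤σ*n {n = zero} w = z≤n
sum1-gap≤σ*n {n = suc n} w =
  ≤-trans (sum1-gap≤lastOccSum w (suc n) ≤-refl) (sum-≤-* (λ a → lastOcc-suc-≤ w a n))

proposition19 : ∃[ C ] (∀ (σ n : ℕ) (w : Word σ n) → activeSum w ≤ C * σ * n)
proposition19 = 4 , activeSum≤4σn
  where
  activeSum≤4σn : ∀ σ n (w : Word σ n) → activeSum w ≤ 4 * σ * n
  activeSum≤4σn σ n w = begin
    activeSum w                        ≤⟨ sum1-mono-≤ n (λ i → <⇒≤ (sumTo-2^-⌊log₂⌋<2* (gap w i + 1) (m≤n+m 1 _))) ⟩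
    sum1 n (λ i → 2 * (gap w i + 1))   ≡⟨ sum1-*-+1 2 n (gap w) ⟩
    2 * (sum1 n (gap w) + n)           ≤⟨ *-monoʳ-≤ 2 (+-mono-≤ (sum1-gap≤σ*n w) (n≤σ*n w)) ⟩
    2 * (σ * n + σ * n)                ≡⟨ double-double σ n ⟩
    4 * σ * n                          ∎
    where
    open ≤-Reasoning
    double-double : ∀ σ n → 2 * (σ * n + σ * n) ≡ 4 * σ * n
    double-double = solve-∀
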